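{- Let $D(p,q)$ for integers $p,q\ge0$ denote the Delannoy numbers, defined by the generating function \[ \frac{1}{1-x-y-xy}=\sum_{p,q=0}^\infty D(p,q)x^py^q, \] and let $D(n)=D(n,n)$ denote the central Delannoy numbers. For integers $p,q\ge0$, \[ D(p,q)=\frac{(-1)^q}{q!}\det\begin{pmatrix}L_{(q+1)\times1}(p) & M_{(q+1)\times q}(p)\end{pmatrix}, \] where the $(q+1)\times(q+1)$ matrix is formed by placing the column $L_{(q+1)\times1}(p)=\bigl(\langle p\rangle_0,\langle p\rangle_1,\dotsc,\langle p\rangle_q\bigr)^T$ to the left of the $(q+1)\times q$ matrix \[ M_{(q+1)\times q}(p)=\Bigl((-1)^{i-j}\binom{i-1}{j-1}\langle p+1\rangle_{i-j}\Bigr)_{1\le i\le q+1,\ 1\le j\le q}, \] whose entries with $i<j$ are $0$. (For $q=0$ the matrix is the $1\times1$ matrix $(\langle p\rangle_0)$.) Consequently, for $n\ge0$, \[ D(n)=\frac{(-1)^n}{n!}\det\begin{pmatrix}L_{(n+1)\times1}(n) & M_{(n+1)\times n}(n)\end{pmatrix}. \]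
   Context: For $z\in\mathbb{C}$ and an integer $n\ge0$, $\langle z\rangle_n$ denotes the falling factorial: $\langle z\rangle_n=z(z-1)\dotsm(z-n+1)$ for $n\ge1$ and $\langle z\rangle_0=1$. The binomial coefficient $\binom{i-1}{j-1}$ is $0$ when $j>i$. Equivalently to the generating function definition, $D(p,q)=\sum_{i=0}^{p}\binom{p}{i}\binom{q}{i}2^i$. -}

module Defs where

open import Data.Nat as ℕ using (ℕ; zero; suc)
open import Data.Nat.Combinatorics using (_C_)
open import Data.Integer as ℤ using (ℤ; +_; -_)
import Relation.Nullary
open import Data.Fin as Fin using (Fin; zero; suc; toℕ; punchIn)

-- Delannoy numbers D(p,q): coefficient of x^p y^q in 1/(1-x-y-xy).
-- Multiplying out (1-x-y-xy) * Σ D(p,q) x^p y^q = 1 gives exactly: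
-- D(0,q) = 1, D(p,0) = 1, D(p+1,q+1) = D(p,q+1) + D(p+1,q) + D(p,q).
D : ℕ → ℕ → ℕ
D zero q = 1
D (suc p) zero = 1
D (suc p) (suc q) = D p (suc q) ℕ.+ D (suc p) q ℕ.+ D p q

Dc : ℕ → ℕ
Dc n = D n n

fall : ℤ → ℕ → ℤ
fall z zero = + 1
fall z (suc n) = fall z n ℤ.* (z ℤ.- + n)

sgn : ℕ → ℤ
sgn zero = + 1
sgn (suc k) = - sgn k

Σ : ∀ {n} → (Fin n → ℤ) → ℤ
Σ {zero} f = + 0
Σ {suc n} f = f zero ℤ.+ Σ (λ i → f (suc i))

det : ∀ n → (Fin n → Fin n → ℤ) → ℤ
det zero A = + 1
det (suc n) A =
  Σ (λ (i : Fin (suc n)) →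
    sgn (toℕ i) ℤ.* A i zero ℤ.* det n (λ r c → A (punchIn i r) (suc c)))

-- The (q+1)×(q+1) matrix ( L_{(q+1)×1}(p)  M_{(q+1)×q}(p) ), 0-indexed rows r and columns c.
-- Column c = suc j' (paper column j = j'+1 of M, paper row i = r+1):
--   (-1)^{i-j} binom(i-1, j-1) ⟨p+1⟩_{i-j}, and 0 when i < j.
LM : (p q : ℕ) → Fin (suc q) → Fin (suc q) → ℤ
LM p q r zero = fall (+ p) (toℕ r)
LM p q r (suc j') with toℕ j' ℕ.≤? toℕ r
... | Relation.Nullary.yes _ =
  sgn (toℕ r ℕ.∸ toℕ j') ℤ.* (+ (toℕ r C toℕ j'))
    ℤ.* fall (+ suc p) (toℕ r ℕ.∸ toℕ j')
... | Relation.Nullary.no _ = + 0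

-- Write the matrix as (a | m) with a = (⟨p⟩ᵢ)ᵢ and m = M(p), which is unit
-- lower triangular.  Expanding along the first column, the minor belonging
-- to row i is block triangular with a unitriangular upper-left block, so it
-- equals a "Hessenberg minor": the determinant of the block of m formed by
-- rows i+1..q and columns i..q-1.  We embed M(p) in the family
-- T k r j = (-1)^{r-j} C(r+k, j+k) ⟨p+1⟩_{r-j}, closed under deleting the
-- first row and column, and show by induction on the size m (expanding each
-- Hessenberg minor along its first column in the same way) that a size-m
-- Hessenberg minor of T k equals (-1)ᵐ (k+1)⋯(k+m) C(p+m, m); the induction
-- step is the vanishing of the coefficients of (1-x)^{p+1}(1-x)^{-(p+1)}.
-- Substituting into the expansion of the full determinant leaves
-- (-1)^q q! Σ_{i+m=q} C(p, i) C(p+m, m), which is D(p, q) by the Delannoy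
-- recurrence.

module Submission where

open import Defs
open import Data.Nat using (ℕ; suc; _!)
open import Data.Integer using (ℤ; +_; _*_)
open import Data.Product using (_×_)
open import Relation.Binary.PropositionalEquality using (_≡_)

open import Data.Nat as ℕ using (zero; _<_; _≤?_; z≤n; s≤s)
import Data.Nat.Properties as ℕP
import Data.Nat.Tactic.RingSolver as ℕSolver
open import Data.Nat.Combinatorics
  using (_C_; nCk+nC[k+1]≡[n+1]C[k+1]; nCn≡1; nC1≡n; nCk≡nC[n∸k])
open import Data.Integer using (-_; _+_; _-_)
import Data.Integer.Properties as ℤP
open import Data.Integer.Tactic.RingSolver using (solve-∀)
open import Data.Fin using (Fin; zero; suc; toℕ; punchIn)
open import Data.Product using (_,_)
open import Relation.Nullary using (yes; no)
open import Relation.Binary.PropositionalEquality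
  using (refl; sym; trans; cong; cong₂; module ≡-Reasoning)
open import Data.Empty using (⊥-elim)

Σ-cong : ∀ {n} {f g : Fin n → ℤ} → (∀ i → f i ≡ g i) → Σ f ≡ Σ g
Σ-cong {zero} f≗g = refl
Σ-cong {suc n} f≗g = cong₂ _+_ (f≗g zero) (Σ-cong (λ i → f≗g (suc i)))

Σ-zero : ∀ {n} (f : Fin n → ℤ) → (∀ i → f i ≡ + 0) → Σ f ≡ + 0
Σ-zero {zero} f f≗0 = refl
Σ-zero {suc n} f f≗0 = cong₂ _+_ (f≗0 zero) (Σ-zero (λ i → f (suc i)) (λ i → f≗0 (suc i)))

det-cong : ∀ n {A B : Fin n → Fin n → ℤ} → (∀ r c → A r c ≡ B r c) → det n A ≡ det n B
det-cong zero A≗B = refl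
det-cong (suc n) A≗B = Σ-cong λ i →
  cong₂ _*_ (cong (sgn (toℕ i) *_) (A≗B i zero)) (det-cong n (λ r c → A≗B (punchIn i r) (suc c)))

det-zero-row : ∀ n (A : Fin (suc n) → Fin (suc n) → ℤ) →
  (∀ c → A zero c ≡ + 0) → det (suc n) A ≡ + 0

-- Deleting a row other than the first keeps the first row (minus its first
-- entry) as the first row of the minor; so if that row is zero beyond its
-- first entry, every such minor has a zero first row and vanishes.
later-minors-vanish : ∀ n (A : Fin (suc n) → Fin (suc n) → ℤ) →
  (∀ c → A zero (suc c) ≡ + 0) → ∀ (i : Fin n) →
  det n (λ r c → A (punchIn (suc i) r) (suc c)) ≡ + 0
later-minors-vanish (suc n) A row≡0 i = det-zero-row n (λ r c → A (punchIn (suc i) r) (suc c)) row≡0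

laterTerm : ∀ n (A : Fin (suc n) → Fin (suc n) → ℤ) → Fin n → ℤ
laterTerm n A i = sgn (suc (toℕ i)) * A (suc i) zero * det n (λ r c → A (punchIn (suc i) r) (suc c))

later-terms-vanish : ∀ n (A : Fin (suc n) → Fin (suc n) → ℤ) →
  (∀ c → A zero (suc c) ≡ + 0) → Σ (laterTerm n A) ≡ + 0
later-terms-vanish n A row≡0 = Σ-zero (laterTerm n A) λ i →
  trans (cong (sgn (suc (toℕ i)) * A (suc i) zero *_) (later-minors-vanish n A row≡0 i))
        (ℤP.*-zeroʳ (sgn (suc (toℕ i)) * A (suc i) zero))

det-zero-row n A row≡0 = cong₂ _+_ first-term (later-terms-vanish n A (λ c → row≡0 (suc c)))
  where
  first-term : sgn 0 * A zero zero * det n (λ r c → A (suc r) (suc c)) ≡ + 0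
  first-term rewrite row≡0 zero = ℤP.*-zeroˡ (det n (λ r c → A (suc r) (suc c)))

det-first-row : ∀ n (A : Fin (suc n) → Fin (suc n) → ℤ) → (∀ c → A zero (suc c) ≡ + 0) →
  det (suc n) A ≡ A zero zero * det n (λ r c → A (suc r) (suc c))
det-first-row n A row≡0 = begin
  sgn 0 * A zero zero * minor + Σ (laterTerm n A)
    ≡⟨ cong₂ _+_ (cong (_* minor) (ℤP.*-identityˡ (A zero zero))) (later-terms-vanish n A row≡0) ⟩
  A zero zero * minor + + 0
    ≡⟨ ℤP.+-identityʳ _ ⟩
  A zero zero * minor ∎
  where
  open ≡-Reasoning
  minor : ℤ
  minor = det n (λ r c → A (suc r) (suc c))

record UnitLowerTriangular (m : ℕ → ℕ → ℤ) : Set where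
  field
    diagonal : ∀ r → m r r ≡ + 1
    upper    : ∀ r j → r < j → m r j ≡ + 0

shift : (ℕ → ℕ → ℤ) → ℕ → ℕ → ℤ
shift m r c = m (suc r) (suc c)

shift-unit : ∀ {m} → UnitLowerTriangular m → UnitLowerTriangular (shift m)
shift-unit U = record
  { diagonal = λ r → diagonal (suc r)
  ; upper    = λ r j r<j → upper (suc r) (suc j) (s≤s r<j) }
  where open UnitLowerTriangular U

-- hessenbergMinor m n i is the determinant of the square block of m formed
-- by rows i+1, …, n and columns i, …, n-1 (of size n - i); such a block has
-- zeros above its superdiagonal.
hessenbergMinor : (ℕ → ℕ → ℤ) → (n : ℕ) → Fin (suc n) → ℤ
hessenbergMinor m n zero = det n (λ r c → m (suc (toℕ r)) (toℕ c))
hessenbergMinor m (suc n) (suc i) = hessenbergMinor (shift m) n i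

hessenbergMinor-cong : ∀ {m m′ : ℕ → ℕ → ℤ} → (∀ r c → m r c ≡ m′ r c) →
  ∀ n i → hessenbergMinor m n i ≡ hessenbergMinor m′ n i
hessenbergMinor-cong m≗m′ n zero = det-cong n (λ r c → m≗m′ _ _)
hessenbergMinor-cong m≗m′ (suc n) (suc i) = hessenbergMinor-cong (λ r c → m≗m′ (suc r) (suc c)) n i

-- Deleting row i from the first n+1 rows and n columns of a unit lower
-- triangular m leaves a block-triangular matrix whose upper-left block is
-- unitriangular; its determinant is therefore the Hessenberg minor.
delete-row-minor : ∀ {m} → UnitLowerTriangular m → ∀ n (i : Fin (suc n)) →
  det n (λ r c → m (toℕ (punchIn i r)) (toℕ c)) ≡ hessenbergMinor m n i
delete-row-minor U n zero = refl
delete-row-minor {m} U (suc n) (suc i) = begin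
  det (suc n) (λ r c → m (toℕ (punchIn (suc i) r)) (toℕ c))
    ≡⟨ det-first-row n (λ r c → m (toℕ (punchIn (suc i) r)) (toℕ c))
                     (λ c → upper 0 (suc (toℕ c)) (s≤s z≤n)) ⟩
  m 0 0 * det n (λ r c → shift m (toℕ (punchIn i r)) (toℕ c))
    ≡⟨ cong₂ _*_ (diagonal 0) (delete-row-minor (shift-unit U) n i) ⟩
  + 1 * hessenbergMinor (shift m) n i
    ≡⟨ ℤP.*-identityˡ _ ⟩
  hessenbergMinor (shift m) n i ∎
  where
  open ≡-Reasoning
  open UnitLowerTriangular U

bordered-expansion : ∀ n (A : Fin (suc n) → Fin (suc n) → ℤ) (a : ℕ → ℤ) {m : ℕ → ℕ → ℤ} →
  UnitLowerTriangular m →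
  (∀ r → A r zero ≡ a (toℕ r)) → (∀ r c → A r (suc c) ≡ m (toℕ r) (toℕ c)) →
  det (suc n) A ≡ Σ (λ i → sgn (toℕ i) * a (toℕ i) * hessenbergMinor m n i)
bordered-expansion n A a U A₀≡a A₊≡m = Σ-cong λ i →
  cong₂ _*_ (cong (sgn (toℕ i) *_) (A₀≡a i))
            (trans (det-cong n (λ r c → A₊≡m (punchIn i r) c)) (delete-row-minor U n i))

-- antidiagonal h N = Σ_{i + m = N} h i m, listed by increasing i.
antidiagonal : (ℕ → ℕ → ℤ) → ℕ → ℤ
antidiagonal h zero = h 0 0
antidiagonal h (suc N) = h 0 (suc N) + antidiagonal (λ i m → h (suc i) m) N

Σ≡antidiagonal : ∀ n (h : ℕ → ℕ → ℤ) →
  Σ {suc n} (λ i → h (toℕ i) (n ℕ.∸ toℕ i)) ≡ antidiagonal h n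
Σ≡antidiagonal zero h = ℤP.+-identityʳ _
Σ≡antidiagonal (suc n) h = cong (_+_ (h 0 (suc n))) (Σ≡antidiagonal n (λ i m → h (suc i) m))

antidiagonal-cong : ∀ N {h h′ : ℕ → ℕ → ℤ} → (∀ i m → i ℕ.+ m ≡ N → h i m ≡ h′ i m) →
  antidiagonal h N ≡ antidiagonal h′ N
antidiagonal-cong zero h≗h′ = h≗h′ 0 0 refl
antidiagonal-cong (suc N) h≗h′ =
  cong₂ _+_ (h≗h′ 0 (suc N) refl)
            (antidiagonal-cong N (λ i m i+m≡N → h≗h′ (suc i) m (cong suc i+m≡N)))

antidiagonal-+ : ∀ N (h h′ : ℕ → ℕ → ℤ) →
  antidiagonal (λ i m → h i m + h′ i m) N ≡ antidiagonal h N + antidiagonal h′ N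
antidiagonal-+ zero h h′ = refl
antidiagonal-+ (suc N) h h′ = begin
  (h 0 (suc N) + h′ 0 (suc N)) + antidiagonal (λ i m → h (suc i) m + h′ (suc i) m) N
    ≡⟨ cong (_+_ (h 0 (suc N) + h′ 0 (suc N))) (antidiagonal-+ N _ _) ⟩
  (h 0 (suc N) + h′ 0 (suc N)) +
  (antidiagonal (λ i m → h (suc i) m) N + antidiagonal (λ i m → h′ (suc i) m) N)
    ≡⟨ interchange (h 0 (suc N)) (h′ 0 (suc N)) _ _ ⟩
  (h 0 (suc N) + antidiagonal (λ i m → h (suc i) m) N) +
  (h′ 0 (suc N) + antidiagonal (λ i m → h′ (suc i) m) N) ∎
  where
  open ≡-Reasoning
  interchange : ∀ a b c d → (a + b) + (c + d) ≡ (a + c) + (b + d)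
  interchange = solve-∀

antidiagonal-scale : ∀ N (c : ℤ) (h : ℕ → ℕ → ℤ) →
  antidiagonal (λ i m → c * h i m) N ≡ c * antidiagonal h N
antidiagonal-scale zero c h = refl
antidiagonal-scale (suc N) c h =
  trans (cong (_+_ (c * h 0 (suc N))) (antidiagonal-scale N c _)) (sym (ℤP.*-distribˡ-+ c _ _))

antidiagonal-negˡ : ∀ N (u v : ℕ → ℤ) →
  antidiagonal (λ i m → (- u i) * v m) N ≡ - antidiagonal (λ i m → u i * v m) N
antidiagonal-negˡ N u v = begin
  antidiagonal (λ i m → (- u i) * v m) N
    ≡⟨ antidiagonal-cong N (λ i m _ → neg-as-scale (u i) (v m)) ⟩
  antidiagonal (λ i m → - + 1 * (u i * v m)) N
    ≡⟨ antidiagonal-scale N (- + 1) (λ i m → u i * v m) ⟩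
  - + 1 * antidiagonal (λ i m → u i * v m) N
    ≡⟨ ℤP.-1*i≡-i (antidiagonal (λ i m → u i * v m) N) ⟩
  - antidiagonal (λ i m → u i * v m) N ∎
  where
  open ≡-Reasoning
  neg-as-scale : ∀ x y → (- x) * y ≡ - + 1 * (x * y)
  neg-as-scale = solve-∀

antidiagonal-zero : ∀ N (h : ℕ → ℕ → ℤ) → (∀ i m → h i m ≡ + 0) → antidiagonal h N ≡ + 0
antidiagonal-zero zero h h≗0 = h≗0 0 0
antidiagonal-zero (suc N) h h≗0 = cong₂ _+_ (h≗0 0 (suc N)) (antidiagonal-zero N _ (λ i m → h≗0 (suc i) m))

-- Antidiagonal sums of products u i · v m are the coefficients of the
-- product of the power series Σ uᵢ xⁱ and Σ vₘ xᵐ.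

antidiagonal-constant : ∀ N (u v : ℕ → ℤ) → (∀ j → u (suc j) ≡ + 0) →
  antidiagonal (λ i m → u i * v m) N ≡ u 0 * v N
antidiagonal-constant zero u v u₊≡0 = refl
antidiagonal-constant (suc N) u v u₊≡0 = begin
  u 0 * v (suc N) + antidiagonal (λ i m → u (suc i) * v m) N
    ≡⟨ cong (_+_ (u 0 * v (suc N))) (antidiagonal-zero N _ λ i m →
         trans (cong (_* v m) (u₊≡0 i)) (ℤP.*-zeroˡ (v m))) ⟩
  u 0 * v (suc N) + + 0
    ≡⟨ ℤP.+-identityʳ _ ⟩
  u 0 * v (suc N) ∎
  where open ≡-Reasoning

-- If u′ = u + x·w (coefficientwise u′₀ = u₀, u′ⱼ₊₁ = uⱼ₊₁ + wⱼ), then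
-- (u′ v)_{N+1} = (u v)_{N+1} + (w v)_N; likewise in the second factor.
antidiagonal-splitˡ : ∀ N (u u′ w v : ℕ → ℤ) →
  u′ 0 ≡ u 0 → (∀ j → u′ (suc j) ≡ u (suc j) + w j) →
  antidiagonal (λ i m → u′ i * v m) (suc N) ≡
  antidiagonal (λ i m → u i * v m) (suc N) + antidiagonal (λ i m → w i * v m) N
antidiagonal-splitˡ N u u′ w v u′₀ u′₊ = begin
  u′ 0 * v (suc N) + antidiagonal (λ i m → u′ (suc i) * v m) N
    ≡⟨ cong₂ _+_ (cong (_* v (suc N)) u′₀) (antidiagonal-cong N λ i m _ →
         trans (cong (_* v m) (u′₊ i)) (ℤP.*-distribʳ-+ (v m) (u (suc i)) (w i))) ⟩
  u 0 * v (suc N) + antidiagonal (λ i m → u (suc i) * v m + w i * v m) N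
    ≡⟨ cong (_+_ (u 0 * v (suc N))) (antidiagonal-+ N _ _) ⟩
  u 0 * v (suc N) + (antidiagonal (λ i m → u (suc i) * v m) N + antidiagonal (λ i m → w i * v m) N)
    ≡⟨ sym (ℤP.+-assoc (u 0 * v (suc N)) _ _) ⟩
  (u 0 * v (suc N) + antidiagonal (λ i m → u (suc i) * v m) N) + antidiagonal (λ i m → w i * v m) N ∎
  where open ≡-Reasoning

antidiagonal-splitʳ : ∀ N (u v v′ w : ℕ → ℤ) →
  v′ 0 ≡ v 0 → (∀ j → v′ (suc j) ≡ v (suc j) + w j) →
  antidiagonal (λ i m → u i * v′ m) (suc N) ≡
  antidiagonal (λ i m → u i * v m) (suc N) + antidiagonal (λ i m → u i * w m) N
antidiagonal-splitʳ zero u v v′ w v′₀ v′₊ rewrite v′₀ | v′₊ 0 =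
  regroup (u 0) (u 1) (v 1) (w 0) (v 0)
  where
  regroup : ∀ a b c d e → a * (c + d) + b * e ≡ (a * c + b * e) + a * d
  regroup = solve-∀
antidiagonal-splitʳ (suc N) u v v′ w v′₀ v′₊
  rewrite v′₊ (suc N) | antidiagonal-splitʳ N (λ i → u (suc i)) v v′ w v′₀ v′₊ =
  regroup (u 0) (v (suc (suc N))) (w (suc N)) _ _
  where
  regroup : ∀ a b c d e → a * (b + c) + (d + e) ≡ (a * b + d) + (a * c + e)
  regroup = solve-∀

-- Binomial coefficients by Pascal's rule; this recursion is what the
-- convolution identities below induct on.  They agree with the library's _C_.
binom : ℕ → ℕ → ℕ
binom n zero = 1
binom zero (suc k) = 0
binom (suc n) (suc k) = binom n k ℕ.+ binom n (suc k)

binom≡C : ∀ n k → binom n k ≡ n C k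
binom≡C n zero = refl
binom≡C zero (suc k) = refl
binom≡C (suc n) (suc k) =
  trans (cong₂ ℕ._+_ (binom≡C n k) (binom≡C n (suc k))) (nCk+nC[k+1]≡[n+1]C[k+1] n k)

binom-diag : ∀ n → binom n n ≡ 1
binom-diag n = trans (binom≡C n n) (nCn≡1 n)

binom-sym : ∀ a b → binom (a ℕ.+ b) a ≡ binom (a ℕ.+ b) b
binom-sym a b = begin
  binom (a ℕ.+ b) a           ≡⟨ binom≡C (a ℕ.+ b) a ⟩
  (a ℕ.+ b) C a               ≡⟨ nCk≡nC[n∸k] (ℕP.m≤m+n a b) ⟩
  (a ℕ.+ b) C (a ℕ.+ b ℕ.∸ a) ≡⟨ cong ((a ℕ.+ b) C_) (ℕP.m+n∸m≡n a b) ⟩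
  (a ℕ.+ b) C b               ≡⟨ sym (binom≡C (a ℕ.+ b) b) ⟩
  binom (a ℕ.+ b) b           ∎
  where open ≡-Reasoning

binom-absorb : ∀ n k → suc k ℕ.* binom (suc n) (suc k) ≡ suc n ℕ.* binom n k
binom-absorb zero zero = refl
binom-absorb zero (suc k) = ℕP.*-zeroʳ (suc (suc k))
binom-absorb (suc n) zero = begin
  1 ℕ.* binom (suc (suc n)) 1 ≡⟨ ℕP.*-identityˡ _ ⟩
  binom (suc (suc n)) 1       ≡⟨ trans (binom≡C (suc (suc n)) 1) (nC1≡n (suc (suc n))) ⟩
  suc (suc n)                 ≡⟨ sym (ℕP.*-identityʳ (suc (suc n))) ⟩
  suc (suc n) ℕ.* 1           ∎
  where open ≡-Reasoning
binom-absorb (suc n) (suc k) = begin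
  suc (suc k) ℕ.* (binom (suc n) (suc k) ℕ.+ binom (suc n) (suc (suc k)))
    ≡⟨ expand (suc k) (binom (suc n) (suc k)) (binom (suc n) (suc (suc k))) ⟩
  binom (suc n) (suc k) ℕ.+ suc k ℕ.* binom (suc n) (suc k) ℕ.+ suc (suc k) ℕ.* binom (suc n) (suc (suc k))
    ≡⟨ cong₂ (λ x y → binom (suc n) (suc k) ℕ.+ x ℕ.+ y) (binom-absorb n k) (binom-absorb n (suc k)) ⟩
  binom (suc n) (suc k) ℕ.+ suc n ℕ.* binom n k ℕ.+ suc n ℕ.* binom n (suc k)
    ≡⟨ collect (binom (suc n) (suc k)) n (binom n k) (binom n (suc k)) ⟩
  suc (suc n) ℕ.* binom (suc n) (suc k) ∎
  where
  open ≡-Reasoning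
  expand : ∀ k a b → suc k ℕ.* (a ℕ.+ b) ≡ a ℕ.+ k ℕ.* a ℕ.+ suc k ℕ.* b
  expand = ℕSolver.solve-∀
  collect : ∀ x n a b → x ℕ.+ suc n ℕ.* a ℕ.+ suc n ℕ.* b ≡ x ℕ.+ suc n ℕ.* (a ℕ.+ b)
  collect = ℕSolver.solve-∀

rising : ℕ → ℕ → ℕ
rising k zero = 1
rising k (suc m) = rising k m ℕ.* suc (k ℕ.+ m)

factorial-rising : ∀ k m → k ! ℕ.* rising k m ≡ (k ℕ.+ m) !
factorial-rising k zero = trans (ℕP.*-identityʳ _) (cong _! (sym (ℕP.+-identityʳ k)))
factorial-rising k (suc m) = begin
  k ! ℕ.* (rising k m ℕ.* suc (k ℕ.+ m))  ≡⟨ sym (ℕP.*-assoc (k !) _ _) ⟩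
  k ! ℕ.* rising k m ℕ.* suc (k ℕ.+ m)    ≡⟨ cong (ℕ._* suc (k ℕ.+ m)) (factorial-rising k m) ⟩
  (k ℕ.+ m) ! ℕ.* suc (k ℕ.+ m)           ≡⟨ ℕP.*-comm ((k ℕ.+ m) !) _ ⟩
  suc (k ℕ.+ m) !                         ≡⟨ cong _! (sym (ℕP.+-suc k m)) ⟩
  (k ℕ.+ suc m) !                         ∎
  where open ≡-Reasoning

rising-split : ∀ k a b → rising k a ℕ.* rising (k ℕ.+ a) b ≡ rising k (a ℕ.+ b)
rising-split k a zero = trans (ℕP.*-identityʳ _) (cong (rising k) (sym (ℕP.+-identityʳ a)))
rising-split k a (suc b) = begin
  rising k a ℕ.* (rising (k ℕ.+ a) b ℕ.* suc (k ℕ.+ a ℕ.+ b))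
    ≡⟨ sym (ℕP.*-assoc (rising k a) _ _) ⟩
  rising k a ℕ.* rising (k ℕ.+ a) b ℕ.* suc (k ℕ.+ a ℕ.+ b)
    ≡⟨ cong₂ ℕ._*_ (rising-split k a b) (cong suc (ℕP.+-assoc k a b)) ⟩
  rising k (a ℕ.+ b) ℕ.* suc (k ℕ.+ (a ℕ.+ b))
    ≡⟨ cong (rising k) (sym (ℕP.+-suc a b)) ⟩
  rising k (a ℕ.+ suc b) ∎
  where open ≡-Reasoning

binom-rising : ∀ k m → binom (k ℕ.+ m) k ℕ.* m ! ≡ rising k m
binom-rising k m = trans (cong (ℕ._* m !) (binom-sym k m)) (lower-index m)
  where
  lower-index : ∀ m → binom (k ℕ.+ m) m ℕ.* m ! ≡ rising k m
  lower-index zero = refl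
  lower-index (suc m) = begin
    binom (k ℕ.+ suc m) (suc m) ℕ.* (suc m ℕ.* m !)
      ≡⟨ cong (λ n → binom n (suc m) ℕ.* (suc m ℕ.* m !)) (ℕP.+-suc k m) ⟩
    binom (suc (k ℕ.+ m)) (suc m) ℕ.* (suc m ℕ.* m !)
      ≡⟨ reassoc (binom (suc (k ℕ.+ m)) (suc m)) m (m !) ⟩
    suc m ℕ.* binom (suc (k ℕ.+ m)) (suc m) ℕ.* m !
      ≡⟨ cong (ℕ._* m !) (binom-absorb (k ℕ.+ m) m) ⟩
    suc (k ℕ.+ m) ℕ.* binom (k ℕ.+ m) m ℕ.* m !
      ≡⟨ ℕP.*-assoc (suc (k ℕ.+ m)) (binom (k ℕ.+ m) m) (m !) ⟩
    suc (k ℕ.+ m) ℕ.* (binom (k ℕ.+ m) m ℕ.* m !)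
      ≡⟨ cong (suc (k ℕ.+ m) ℕ.*_) (lower-index m) ⟩
    suc (k ℕ.+ m) ℕ.* rising k m
      ≡⟨ ℕP.*-comm (suc (k ℕ.+ m)) _ ⟩
    rising k (suc m) ∎
    where
    open ≡-Reasoning
    reassoc : ∀ b m f → b ℕ.* (suc m ℕ.* f) ≡ suc m ℕ.* b ℕ.* f
    reassoc = ℕSolver.solve-∀

fall-suc : ∀ z i → fall z (suc i) ≡ z * fall (z - + 1) i
fall-suc z zero = one-factor z
  where
  one-factor : ∀ z → + 1 * (z - + 0) ≡ z * + 1
  one-factor = solve-∀
fall-suc z (suc i) = begin
  fall z (suc i) * (z - + suc i)
    ≡⟨ cong (_* (z - + suc i)) (fall-suc z i) ⟩
  z * fall (z - + 1) i * (z - (+ 1 + + i))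
    ≡⟨ reassoc z (fall (z - + 1) i) (+ i) ⟩
  z * (fall (z - + 1) i * (z - + 1 - + i)) ∎
  where
  open ≡-Reasoning
  reassoc : ∀ z f i → z * f * (z - (+ 1 + i)) ≡ z * (f * (z - + 1 - i))
  reassoc = solve-∀

fall-binom : ∀ n i → fall (+ n) i ≡ + (i ! ℕ.* binom n i)
fall-binom n zero = refl
fall-binom zero (suc i) = begin
  fall (+ 0) (suc i)           ≡⟨ fall-suc (+ 0) i ⟩
  + 0 * fall (- + 1) i         ≡⟨ ℤP.*-zeroˡ (fall (- + 1) i) ⟩
  + 0                          ≡⟨ cong +_ (sym (ℕP.*-zeroʳ (suc i !))) ⟩
  + (suc i ! ℕ.* 0)            ∎
  where open ≡-Reasoning
fall-binom (suc n) (suc i) = begin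
  fall (+ suc n) (suc i)
    ≡⟨ fall-suc (+ suc n) i ⟩
  + suc n * fall (+ n) i
    ≡⟨ cong (+ suc n *_) (fall-binom n i) ⟩
  + suc n * + (i ! ℕ.* binom n i)
    ≡⟨ sym (ℤP.pos-* (suc n) _) ⟩
  + (suc n ℕ.* (i ! ℕ.* binom n i))
    ≡⟨ cong +_ (swap (suc n) (i !) (binom n i)) ⟩
  + (i ! ℕ.* (suc n ℕ.* binom n i))
    ≡⟨ cong (λ x → + (i ! ℕ.* x)) (sym (binom-absorb n i)) ⟩
  + (i ! ℕ.* (suc i ℕ.* binom (suc n) (suc i)))
    ≡⟨ cong +_ (swap (i !) (suc i) (binom (suc n) (suc i))) ⟩
  + (suc i ℕ.* (i ! ℕ.* binom (suc n) (suc i)))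
    ≡⟨ cong +_ (sym (ℕP.*-assoc (suc i) (i !) _)) ⟩
  + (suc i ! ℕ.* binom (suc n) (suc i)) ∎
  where
  open ≡-Reasoning
  swap : ∀ a b c → a ℕ.* (b ℕ.* c) ≡ b ℕ.* (a ℕ.* c)
  swap = ℕSolver.solve-∀

sgn-+ : ∀ a b → sgn (a ℕ.+ b) ≡ sgn a * sgn b
sgn-+ zero b = sym (ℤP.*-identityˡ (sgn b))
sgn-+ (suc a) b = trans (cong -_ (sgn-+ a b)) (ℤP.neg-distribˡ-* (sgn a) (sgn b))

sgn-square : ∀ n → sgn n * sgn n ≡ + 1
sgn-square zero = refl
sgn-square (suc n) = trans (neg-square (sgn n)) (sgn-square n)
  where
  neg-square : ∀ x → (- x) * (- x) ≡ x * x
  neg-square = solve-∀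

-- alt a j = (-1)ʲ C(a, j), the coefficients of (1 - x)ᵃ; Pascal's rule
-- becomes (1 - x)^{a+1} = (1 - x)ᵃ - x (1 - x)ᵃ.
alt : ℕ → ℕ → ℤ
alt a j = sgn j * + binom a j

alt-pascal : ∀ a j → alt (suc a) (suc j) ≡ alt a (suc j) + - alt a j
alt-pascal a j = distribute (sgn j) (+ binom a j) (+ binom a (suc j))
  where
  distribute : ∀ s x y → (- s) * (x + y) ≡ (- s) * y + - (s * x)
  distribute = solve-∀

-- Since Σₘ C(s+m, m) xᵐ = (1 - x)^{-(s+1)}, the identity
-- (1 - x)ᵃ (1 - x)^{-(t+a+1)} = (1 - x)^{-(t+1)} reads coefficientwise:
-- Σ_{i+m=N} (-1)ⁱ C(a, i) C(t+a+m, m) = C(t+N, N).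
alt-antidiagonal : ∀ a t N →
  antidiagonal (λ i m → alt a i * + binom (t ℕ.+ a ℕ.+ m) m) N ≡ + binom (t ℕ.+ N) N
alt-antidiagonal zero t N = begin
  antidiagonal (λ i m → alt 0 i * + binom (t ℕ.+ 0 ℕ.+ m) m) N
    ≡⟨ antidiagonal-constant N (alt 0) (λ m → + binom (t ℕ.+ 0 ℕ.+ m) m)
                             (λ j → ℤP.*-zeroʳ (sgn (suc j))) ⟩
  + 1 * + binom (t ℕ.+ 0 ℕ.+ N) N
    ≡⟨ ℤP.*-identityˡ _ ⟩
  + binom (t ℕ.+ 0 ℕ.+ N) N
    ≡⟨ cong (λ s → + binom (s ℕ.+ N) N) (ℕP.+-identityʳ t) ⟩
  + binom (t ℕ.+ N) N ∎
  where open ≡-Reasoning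
alt-antidiagonal (suc a) t zero = refl
alt-antidiagonal (suc a) t (suc N) = begin
  antidiagonal (λ i m → alt (suc a) i * v m) (suc N)
    ≡⟨ antidiagonal-splitˡ N (alt a) (alt (suc a)) (λ j → - alt a j) v refl (alt-pascal a) ⟩
  antidiagonal (λ i m → alt a i * v m) (suc N) + antidiagonal (λ i m → (- alt a i) * v m) N
    ≡⟨ cong (_+_ (antidiagonal (λ i m → alt a i * v m) (suc N))) (antidiagonal-negˡ N (alt a) v) ⟩
  antidiagonal (λ i m → alt a i * v m) (suc N) + - antidiagonal (λ i m → alt a i * v m) N
    ≡⟨ cong₂ (λ x y → x + - y)
         (trans (antidiagonal-cong (suc N) (λ i m _ → v≡ i m)) (alt-antidiagonal a (suc t) (suc N)))
         (trans (antidiagonal-cong N (λ i m _ → v≡ i m)) (alt-antidiagonal a (suc t) N)) ⟩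
  + binom (suc t ℕ.+ suc N) (suc N) + - + binom (suc t ℕ.+ N) N
    ≡⟨ cong (λ s → + binom (suc t ℕ.+ suc N) (suc N) + - + binom s N) (sym (ℕP.+-suc t N)) ⟩
  (+ binom (t ℕ.+ suc N) N + + binom (t ℕ.+ suc N) (suc N)) + - + binom (t ℕ.+ suc N) N
    ≡⟨ cancel (+ binom (t ℕ.+ suc N) N) (+ binom (t ℕ.+ suc N) (suc N)) ⟩
  + binom (t ℕ.+ suc N) (suc N) ∎
  where
  open ≡-Reasoning
  v : ℕ → ℤ
  v m = + binom (t ℕ.+ suc a ℕ.+ m) m
  v≡ : ∀ i m → alt a i * v m ≡ alt a i * + binom (suc t ℕ.+ a ℕ.+ m) m
  v≡ i m = cong (λ s → alt a i * + binom (s ℕ.+ m) m) (ℕP.+-suc t a)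
  cancel : ∀ x y → (x + y) + - x ≡ y
  cancel = solve-∀

-- (1 - x)^{a+1} (1 - x)^{-(a+1)} = 1: the coefficients of positive degree vanish.
alt-antidiagonal-vanishes : ∀ a N →
  antidiagonal (λ i m → alt (suc a) i * + binom (a ℕ.+ m) m) (suc N) ≡ + 0
alt-antidiagonal-vanishes a N = begin
  antidiagonal (λ i m → alt (suc a) i * v m) (suc N)
    ≡⟨ antidiagonal-splitˡ N (alt a) (alt (suc a)) (λ j → - alt a j) v refl (alt-pascal a) ⟩
  antidiagonal (λ i m → alt a i * v m) (suc N) + antidiagonal (λ i m → (- alt a i) * v m) N
    ≡⟨ cong₂ _+_ (alt-antidiagonal a 0 (suc N))
                 (trans (antidiagonal-negˡ N (alt a) v) (cong -_ (alt-antidiagonal a 0 N))) ⟩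
  + binom (suc N) (suc N) + - + binom N N
    ≡⟨ cong₂ (λ x y → + x + - + y) (binom-diag (suc N)) (binom-diag N) ⟩
  + 0 ∎
  where
  open ≡-Reasoning
  v : ℕ → ℤ
  v m = + binom (a ℕ.+ m) m

-- The Delannoy numbers as a binomial convolution:
-- D(p, q) = Σ_{i+m=q} C(p, i) C(p+m, m), proved from the recurrence of D
-- by Pascal's rule in each factor.
delannoy-antidiagonal : ∀ p q → antidiagonal (λ i m → + binom p i * + binom (p ℕ.+ m) m) q ≡ + D p q
delannoy-antidiagonal zero q = begin
  antidiagonal (λ i m → + binom 0 i * + binom m m) q
    ≡⟨ antidiagonal-constant q (λ i → + binom 0 i) (λ m → + binom m m) (λ j → refl) ⟩
  + 1 * + binom q q
    ≡⟨ trans (ℤP.*-identityˡ _) (cong +_ (binom-diag q)) ⟩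
  + 1 ∎
  where open ≡-Reasoning
delannoy-antidiagonal (suc p) zero = refl
delannoy-antidiagonal (suc p) (suc q) = begin
  antidiagonal (λ i m → u₁ i * v₁ m) (suc q)
    ≡⟨ antidiagonal-splitʳ q u₁ v₀ v₁ v₁ refl v-pascal ⟩
  antidiagonal (λ i m → u₁ i * v₀ m) (suc q) + antidiagonal (λ i m → u₁ i * v₁ m) q
    ≡⟨ cong₂ _+_ (antidiagonal-splitˡ q u₀ u₁ u₀ v₀ refl u-pascal) (delannoy-antidiagonal (suc p) q) ⟩
  (antidiagonal (λ i m → u₀ i * v₀ m) (suc q) + antidiagonal (λ i m → u₀ i * v₀ m) q) + + D (suc p) q
    ≡⟨ cong₂ (λ x y → (x + y) + + D (suc p) q)
             (delannoy-antidiagonal p (suc q)) (delannoy-antidiagonal p q) ⟩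
  (+ D p (suc q) + + D p q) + + D (suc p) q
    ≡⟨ cong +_ (rearrange (D p (suc q)) (D p q) (D (suc p) q)) ⟩
  + D (suc p) (suc q) ∎
  where
  open ≡-Reasoning
  u₁ u₀ v₁ v₀ : ℕ → ℤ
  u₁ i = + binom (suc p) i
  u₀ i = + binom p i
  v₁ m = + binom (suc p ℕ.+ m) m
  v₀ m = + binom (p ℕ.+ m) m
  u-pascal : ∀ j → u₁ (suc j) ≡ u₀ (suc j) + u₀ j
  u-pascal j = cong +_ (ℕP.+-comm (binom p j) _)
  v-pascal : ∀ j → v₁ (suc j) ≡ v₀ (suc j) + v₁ j
  v-pascal j = cong +_ (trans (ℕP.+-comm (binom (p ℕ.+ suc j) j) _)
                              (cong (λ n → binom (p ℕ.+ suc j) (suc j) ℕ.+ binom n j) (ℕP.+-suc p j)))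
  rearrange : ∀ a b c → (a ℕ.+ b) ℕ.+ c ≡ a ℕ.+ c ℕ.+ b
  rearrange = ℕSolver.solve-∀

module DelannoyMatrix (p : ℕ) where

  -- T k r j = (-1)^{r-j} C(r+k, j+k) ⟨p+1⟩_{r-j} for j ≤ r, and 0 above the
  -- diagonal.  T 0 is the block M(p) of the theorem, and deleting the first
  -- row and column of T k gives T (k+1).
  T : ℕ → ℕ → ℕ → ℤ
  T k r j with j ≤? r
  ... | yes _ = sgn (r ℕ.∸ j) * + binom (r ℕ.+ k) (j ℕ.+ k) * fall (+ suc p) (r ℕ.∸ j)
  ... | no _ = + 0

  T-unit : ∀ k → UnitLowerTriangular (T k)
  T-unit k = record { diagonal = diagonal ; upper = upper }
    where
    diagonal : ∀ r → T k r r ≡ + 1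
    diagonal r with r ≤? r
    ... | yes _ rewrite ℕP.n∸n≡0 r | binom-diag (r ℕ.+ k) = refl
    ... | no r≰r = ⊥-elim (r≰r ℕP.≤-refl)
    upper : ∀ r j → r < j → T k r j ≡ + 0
    upper r j r<j with j ≤? r
    ... | yes j≤r = ⊥-elim (ℕP.<⇒≱ r<j j≤r)
    ... | no _ = refl

  T-shift : ∀ k r j → shift (T k) r j ≡ T (suc k) r j
  T-shift k r j with suc j ≤? suc r | j ≤? r
  ... | yes _ | yes _ rewrite ℕP.+-suc r k | ℕP.+-suc j k = refl
  ... | yes (s≤s j≤r) | no j≰r = ⊥-elim (j≰r j≤r)
  ... | no 1+j≰1+r | yes j≤r = ⊥-elim (1+j≰1+r (s≤s j≤r))
  ... | no _ | no _ = refl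

  T-first-column : ∀ k i → T k (suc i) 0 ≡ sgn (suc i) * (+ rising k (suc i) * + binom (suc p) (suc i))
  T-first-column k i = begin
    sgn (suc i) * + binom (suc i ℕ.+ k) k * fall (+ suc p) (suc i)
      ≡⟨ cong₂ (λ n x → sgn (suc i) * + binom n k * x)
               (ℕP.+-comm (suc i) k) (fall-binom (suc p) (suc i)) ⟩
    sgn (suc i) * + binom (k ℕ.+ suc i) k * + (suc i ! ℕ.* binom (suc p) (suc i))
      ≡⟨ cong (sgn (suc i) * + binom (k ℕ.+ suc i) k *_) (ℤP.pos-* (suc i !) _) ⟩
    sgn (suc i) * + binom (k ℕ.+ suc i) k * (+ (suc i !) * + binom (suc p) (suc i))
      ≡⟨ reassoc (sgn (suc i)) (+ binom (k ℕ.+ suc i) k) (+ (suc i !)) (+ binom (suc p) (suc i)) ⟩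
    sgn (suc i) * (+ binom (k ℕ.+ suc i) k * + (suc i !) * + binom (suc p) (suc i))
      ≡⟨ cong (λ x → sgn (suc i) * (x * + binom (suc p) (suc i)))
              (trans (sym (ℤP.pos-* (binom (k ℕ.+ suc i) k) _)) (cong +_ (binom-rising k (suc i)))) ⟩
    sgn (suc i) * (+ rising k (suc i) * + binom (suc p) (suc i)) ∎
    where
    open ≡-Reasoning
    reassoc : ∀ s a b c → s * a * (b * c) ≡ s * (a * b * c)
    reassoc = solve-∀

  minorValue : ℕ → ℕ → ℤ
  minorValue j m = sgn m * (+ rising j m * + binom (p ℕ.+ m) m)

  hessenberg-term : ∀ k i m →
    sgn i * (sgn (suc i) * (+ rising k (suc i) * + binom (suc p) (suc i))) * minorValue (suc k ℕ.+ i) m ≡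
    + rising k (suc (i ℕ.+ m)) * (sgn (i ℕ.+ m) * (alt (suc p) (suc i) * + binom (p ℕ.+ m) m))
  hessenberg-term k i m = begin
    sgn i * (sgn (suc i) * (+ rising k (suc i) * b)) * (sgn m * (+ rising (suc k ℕ.+ i) m * b′))
      ≡⟨ cong (λ j → sgn i * (sgn (suc i) * (+ rising k (suc i) * b)) * (sgn m * (+ rising j m * b′)))
              (sym (ℕP.+-suc k i)) ⟩
    sgn i * (sgn (suc i) * (+ rising k (suc i) * b)) * (sgn m * (+ rising (k ℕ.+ suc i) m * b′))
      ≡⟨ regroup (sgn i) (sgn (suc i)) (+ rising k (suc i)) b (sgn m) (+ rising (k ℕ.+ suc i) m) b′ ⟩
    (+ rising k (suc i) * + rising (k ℕ.+ suc i) m) * ((sgn i * sgn m) * ((sgn (suc i) * b) * b′))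
      ≡⟨ cong₂ (λ x s → x * (s * ((sgn (suc i) * b) * b′)))
               (trans (sym (ℤP.pos-* (rising k (suc i)) _)) (cong +_ (rising-split k (suc i) m)))
               (sym (sgn-+ i m)) ⟩
    + rising k (suc (i ℕ.+ m)) * (sgn (i ℕ.+ m) * ((sgn (suc i) * b) * b′)) ∎
    where
    open ≡-Reasoning
    b b′ : ℤ
    b = + binom (suc p) (suc i)
    b′ = + binom (p ℕ.+ m) m
    regroup : ∀ a b c d e f g → a * (b * (c * d)) * (e * (f * g)) ≡ (c * f) * ((a * e) * ((b * d) * g))
    regroup = solve-∀

  -- Expanding along
  -- its first column gives (-1)ⁿ (k+1)⋯(k+n+1) times the degree n+1
  -- coefficient of (1 - x)^{p+1} (1 - x)^{-(p+1)} minus its i = 0 term.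
  hessenberg-step : ∀ n k →
    (∀ i → hessenbergMinor (T (suc k)) n i ≡ minorValue (suc k ℕ.+ toℕ i) (n ℕ.∸ toℕ i)) →
    hessenbergMinor (T k) (suc n) zero ≡ minorValue k (suc n)
  hessenberg-step n k minors = begin
    det (suc n) (λ r c → T k (suc (toℕ r)) (toℕ c))
      ≡⟨ bordered-expansion n (λ r c → T k (suc (toℕ r)) (toℕ c)) (λ r → T k (suc r) 0)
           (T-unit (suc k)) (λ r → refl) (λ r c → T-shift k (toℕ r) (toℕ c)) ⟩
    Σ {suc n} (λ i → sgn (toℕ i) * T k (suc (toℕ i)) 0 * hessenbergMinor (T (suc k)) n i)
      ≡⟨ Σ-cong {suc n} (λ i → cong₂ (λ x y → sgn (toℕ i) * x * y)
                                     (T-first-column k (toℕ i)) (minors i)) ⟩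
    Σ {suc n} (λ i → term (toℕ i) (n ℕ.∸ toℕ i))
      ≡⟨ Σ≡antidiagonal n term ⟩
    antidiagonal term n
      ≡⟨ antidiagonal-cong n on-antidiagonal ⟩
    antidiagonal (λ i m → + rising k (suc n) * (sgn n * (alt (suc p) (suc i) * + binom (p ℕ.+ m) m))) n
      ≡⟨ antidiagonal-scale n (+ rising k (suc n)) _ ⟩
    + rising k (suc n) * antidiagonal (λ i m → sgn n * (alt (suc p) (suc i) * + binom (p ℕ.+ m) m)) n
      ≡⟨ cong (+ rising k (suc n) *_) (antidiagonal-scale n (sgn n) _) ⟩
    + rising k (suc n) * (sgn n * tail)
      ≡⟨ cong (λ x → + rising k (suc n) * (sgn n * x))
              (trans (add-and-remove head tail) (cong (_+ - head) (alt-antidiagonal-vanishes p n))) ⟩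
    + rising k (suc n) * (sgn n * (+ 0 + - head))
      ≡⟨ simplify (+ rising k (suc n)) (sgn n) (+ binom (p ℕ.+ suc n) (suc n)) ⟩
    minorValue k (suc n) ∎
    where
    open ≡-Reasoning
    term : ℕ → ℕ → ℤ
    term i m = sgn i * (sgn (suc i) * (+ rising k (suc i) * + binom (suc p) (suc i))) * minorValue (suc k ℕ.+ i) m
    on-antidiagonal : ∀ i m → i ℕ.+ m ≡ n →
      term i m ≡ + rising k (suc n) * (sgn n * (alt (suc p) (suc i) * + binom (p ℕ.+ m) m))
    on-antidiagonal i m refl = hessenberg-term k i m
    head tail : ℤ
    head = alt (suc p) 0 * + binom (p ℕ.+ suc n) (suc n)
    tail = antidiagonal (λ i m → alt (suc p) (suc i) * + binom (p ℕ.+ m) m) n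
    add-and-remove : ∀ x y → y ≡ (x + y) + - x
    add-and-remove = solve-∀
    simplify : ∀ a s b → a * (s * (+ 0 + - (+ 1 * b))) ≡ (- s) * (a * b)
    simplify = solve-∀

  minors-closed : ∀ n k (i : Fin (suc n)) →
    hessenbergMinor (T k) n i ≡ minorValue (k ℕ.+ toℕ i) (n ℕ.∸ toℕ i)
  minors-closed zero k zero = refl
  minors-closed (suc n) k zero =
    trans (hessenberg-step n k (minors-closed n (suc k)))
          (cong (λ j → minorValue j (suc n)) (sym (ℕP.+-identityʳ k)))
  minors-closed (suc n) k (suc i) = begin
    hessenbergMinor (shift (T k)) n i          ≡⟨ hessenbergMinor-cong (T-shift k) n i ⟩
    hessenbergMinor (T (suc k)) n i            ≡⟨ minors-closed n (suc k) i ⟩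
    minorValue (suc k ℕ.+ toℕ i) (n ℕ.∸ toℕ i)
      ≡⟨ cong (λ j → minorValue j (n ℕ.∸ toℕ i)) (sym (ℕP.+-suc k (toℕ i))) ⟩
    minorValue (k ℕ.+ suc (toℕ i)) (n ℕ.∸ toℕ i) ∎
    where open ≡-Reasoning

  LM≡T : ∀ q (r : Fin (suc q)) (c : Fin q) → LM p q r (suc c) ≡ T 0 (toℕ r) (toℕ c)
  LM≡T q r c with toℕ c ≤? toℕ r
  ... | yes _ rewrite ℕP.+-identityʳ (toℕ r) | ℕP.+-identityʳ (toℕ c) | binom≡C (toℕ r) (toℕ c) = refl
  ... | no _ = refl

  LM-term : ∀ i m → sgn i * + (i ! ℕ.* binom p i) * minorValue i m ≡
    sgn (i ℕ.+ m) * + ((i ℕ.+ m) !) * (+ binom p i * + binom (p ℕ.+ m) m)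
  LM-term i m = begin
    sgn i * + (i ! ℕ.* binom p i) * (sgn m * (+ rising i m * b′))
      ≡⟨ cong (λ x → sgn i * x * (sgn m * (+ rising i m * b′))) (ℤP.pos-* (i !) (binom p i)) ⟩
    sgn i * (+ (i !) * + binom p i) * (sgn m * (+ rising i m * b′))
      ≡⟨ regroup (sgn i) (+ (i !)) (+ binom p i) (sgn m) (+ rising i m) b′ ⟩
    (sgn i * sgn m) * (+ (i !) * + rising i m) * (+ binom p i * b′)
      ≡⟨ cong₂ (λ s x → s * x * (+ binom p i * b′))
               (sym (sgn-+ i m)) (trans (sym (ℤP.pos-* (i !) _)) (cong +_ (factorial-rising i m))) ⟩
    sgn (i ℕ.+ m) * + ((i ℕ.+ m) !) * (+ binom p i * b′) ∎
    where
    open ≡-Reasoning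
    b′ : ℤ
    b′ = + binom (p ℕ.+ m) m
    regroup : ∀ a b c d e f → a * (b * c) * (d * (e * f)) ≡ (a * d) * (b * e) * (c * f)
    regroup = solve-∀

  det-LM : ∀ q → det (suc q) (LM p q) ≡ sgn q * + (q !) * + D p q
  det-LM q = begin
    det (suc q) (LM p q)
      ≡⟨ bordered-expansion q (LM p q) (fall (+ p)) (T-unit 0) (λ r → refl) (LM≡T q) ⟩
    Σ {suc q} (λ i → sgn (toℕ i) * fall (+ p) (toℕ i) * hessenbergMinor (T 0) q i)
      ≡⟨ Σ-cong {suc q} (λ i → cong₂ (λ x y → sgn (toℕ i) * x * y)
                                     (fall-binom p (toℕ i)) (minors-closed q 0 i)) ⟩
    Σ {suc q} (λ i → term (toℕ i) (q ℕ.∸ toℕ i))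
      ≡⟨ Σ≡antidiagonal q term ⟩
    antidiagonal term q
      ≡⟨ antidiagonal-cong q on-antidiagonal ⟩
    antidiagonal (λ i m → sgn q * + (q !) * (+ binom p i * + binom (p ℕ.+ m) m)) q
      ≡⟨ antidiagonal-scale q (sgn q * + (q !)) _ ⟩
    sgn q * + (q !) * antidiagonal (λ i m → + binom p i * + binom (p ℕ.+ m) m) q
      ≡⟨ cong (sgn q * + (q !) *_) (delannoy-antidiagonal p q) ⟩
    sgn q * + (q !) * + D p q ∎
    where
    open ≡-Reasoning
    term : ℕ → ℕ → ℤ
    term i m = sgn i * + (i ! ℕ.* binom p i) * minorValue i m
    on-antidiagonal : ∀ i m → i ℕ.+ m ≡ q →
      term i m ≡ sgn q * + (q !) * (+ binom p i * + binom (p ℕ.+ m) m)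
    on-antidiagonal i m refl = LM-term i m

theorem2p1 : ((p q : ℕ) → + (q !) * + D p q ≡ sgn q * det (suc q) (LM p q))
    × ((n : ℕ) → + (n !) * + Dc n ≡ sgn n * det (suc n) (LM n n))
theorem2p1 = delannoy-det , λ n → delannoy-det n n
  where
  delannoy-det : (p q : ℕ) → + (q !) * + D p q ≡ sgn q * det (suc q) (LM p q)
  delannoy-det p q = sym (begin
    sgn q * det (suc q) (LM p q)          ≡⟨ cong (sgn q *_) (DelannoyMatrix.det-LM p q) ⟩
    sgn q * (sgn q * + (q !) * + D p q)   ≡⟨ regroup (sgn q) (+ (q !)) (+ D p q) ⟩
    (sgn q * sgn q) * (+ (q !) * + D p q) ≡⟨ cong (_* (+ (q !) * + D p q)) (sgn-square q) ⟩
    + 1 * (+ (q !) * + D p q)             ≡⟨ ℤP.*-identityˡ _ ⟩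
    + (q !) * + D p q                     ∎)
    where
    open ≡-Reasoning
    regroup : ∀ s a b → s * (s * a * b) ≡ (s * s) * (a * b)
    regroup = solve-∀
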